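{- Let $R=\{1,\dots,11\}$, $C=\{12,\dots,22\}$, $S=\{23,\dots,33\}$, and consider the following permutations of $R\cup C\cup S$: $\gamma_1=(1,2)(3,4)(5,6)(12,13)(14,15)(16,17)(23,24)(25,26)(27,28)$, $\gamma_2=(12,23)(13,24)(14,25)(15,26)(16,27)(17,28)(18,31)(19,29)(20,30)(21,32)(22,33)$, $\gamma_4=(1,2)(8,10)(9,11)(16,17)(19,22)(20,21)(27,28)(29,33)(30,32)$, $\gamma_5=(1,2)(8,10)(9,11)(12,14)(13,15)(19,22)(23,25)(24,26)(29,33)$, $\gamma_6=(1,2)(12,23)(13,24)(14,25)(15,26)(16,27)(17,28)(18,31)(19,29)(20,30)(21,32)(22,33)$, $\gamma_{10}=(1,2)(3,5)(4,6)(8,10)(9,11)(12,23)(13,24)(14,25)(15,26)(16,27)(17,28)(18,31)(19,29)(20,30)(21,32)(22,33)$, $\gamma_{11}=(1,2)(8,10)(9,11)(16,17)(19,22)(20,21)(23,25)(24,26)(29,33)$, $\gamma_{14}=(3,5)(4,6)(9,11)(12,14)(13,15)(19,22)(23,25)(24,26)(29,33)$, $\gamma_{16}=(1,2)(3,4)(5,6)(7,8)(12,13)(14,15)(16,17)(18,19)(23,24)(25,26)(27,28)(29,30)$, $\gamma_{18}=(1,3)(2,4)(5,7)(6,8)(12,15)(13,14)(16,17)(21,22)(23,26)(24,25)(27,28)(32,33)$, $\gamma_{26}=(1,3)(2,4)(5,7)(6,8)(10,11)(12,23)(13,24)(14,25)(15,26)(16,27)(17,28)(18,29)(19,30)(20,31)(21,33)(22,32)$,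 $\gamma_{29}=(1,3)(2,4)(7,8)(10,11)(12,14)(13,15)(16,18)(17,19)(23,26)(24,25)(27,30)(28,29)$, $\gamma_{43}=(1,2,3,4)(5,6,7,8)(12,13,14,15)(16,17,18,19)(20,21)(23,24,25,26)(27,28,29,30)(31,32)$, $\gamma_{44}=(1,2,3,4)(5,6,7,8)(12,13,14,15)(16,17,18,19)(23,24,25,26)(27,28,29,30)(31,32)$. Let $\Pi$ be any one of the following twelve groups: $\langle\gamma_1,\gamma_2\rangle$, $\langle\gamma_1,\gamma_4\rangle$, $\langle\gamma_1,\gamma_5\rangle$, $\langle\gamma_1,\gamma_6\rangle$, $\langle\gamma_1,\gamma_{10}\rangle$, $\langle\gamma_1,\gamma_{11}\rangle$, $\langle\gamma_1,\gamma_{14}\rangle$, $\langle\gamma_{16},\gamma_{18}\rangle$, $\langle\gamma_{16},\gamma_{26}\rangle$, $\langle\gamma_{16},\gamma_{29}\rangle$, $\langle\gamma_{43}\rangle$, $\langle\gamma_{44}\rangle$. Then there is no Latin square $\mathcal{L}$ of order $11$ (on point classes $R,C,S$) such that $\pi(\mathcal{L})=\mathcal{L}$ for every $\pi\in\Pi$.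
   Context: A Latin square of order $n$ on the pairwise disjoint $n$-element point classes $R$, $C$, $S$ is a set $\mathcal{L}$ of triples, each containing exactly one point of each of $R,C,S$, such that any two points from different point classes occur together in exactly one triple of $\mathcal{L}$. A permutation $\pi$ of $R\cup C\cup S$ acts on $\mathcal{L}$ by $\pi(\mathcal{L})=\{\pi(t):t\in\mathcal{L}\}$ where $\pi(t)$ is the image of the triple $t$ as a set. -}

module Defs where

open import Data.Nat using (ℕ; zero; suc; _<?_; _/_; _≡ᵇ_; pred)
open import Data.Fin using (Fin; toℕ; fromℕ<)
open import Data.Bool using (if_then_else_)
open import Data.Maybe using (Maybe; just; nothing)
open import Data.List using (List; []; _∷_)
open import Data.List.Membership.Propositional using (_∈_)
open import Data.Product using (Σ; ∃; _×_; _,_)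
open import Data.Sum using (_⊎_)
open import Relation.Nullary using (yes; no)
open import Relation.Binary.PropositionalEquality using (_≡_)

-- The 33 points 1,…,33 of the paper are represented by Fin 33;
-- the element p : Fin 33 stands for the paper's point  toℕ p + 1.
-- R = {1..11}, C = {12..22}, S = {23..33}, i.e. class 0, 1, 2 below.

Point : Set
Point = Fin 33

cls : Point → ℕ
cls p = toℕ p / 11

InR InC InS : Point → Set
InR p = cls p ≡ 0
InC p = cls p ≡ 1
InS p = cls p ≡ 2

-- Triples and (finite) sets of triples.
-- A triple {a,b,c} is written as an ordered triple (a , b , c); it is
-- only regarded as a set through  _∈ₜ_  and  SameSet.

Triple : Set
Triple = Point × Point × Point

_∈ₜ_ : Point → Triple → Set
p ∈ₜ (a , b , c) = p ≡ a ⊎ p ≡ b ⊎ p ≡ c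

SameSet : Triple → Triple → Set
SameSet t u = ∀ p → (p ∈ₜ t → p ∈ₜ u) × (p ∈ₜ u → p ∈ₜ t)

TripleSet : Set₁
TripleSet = Triple → Set

ExactlyOneTripleThrough : TripleSet → Point → Point → Set
ExactlyOneTripleThrough L p q =
  Σ Triple λ t → L t × p ∈ₜ t × q ∈ₜ t ×
    (∀ u → L u → p ∈ₜ u → q ∈ₜ u → u ≡ t)

IsLatinSquare : TripleSet → Set
IsLatinSquare L =
  (∀ a b c → L (a , b , c) → InR a × InC b × InS c) ×
  (∀ p q → (cls p ≡ cls q → Data.Empty.⊥) → ExactlyOneTripleThrough L p q)
  where import Data.Empty

Perm : Set
Perm = Point → Point

imageTriple : Perm → Triple → Triple
imageTriple π (a , b , c) = (π a , π b , π c)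

-- π(L) = L  as sets of (unordered) triples
Fixes : Perm → TripleSet → Set
Fixes π L =
  (∀ t → L t → ∃ λ u → L u × SameSet (imageTriple π t) u) ×
  (∀ u → L u → ∃ λ t → L t × SameSet (imageTriple π t) u)

private
  nextIn : ℕ → List ℕ → ℕ → Maybe ℕ
  nextIn f [] x = nothing
  nextIn f (a ∷ []) x = if a ≡ᵇ x then just f else nothing
  nextIn f (a ∷ b ∷ r) x = if a ≡ᵇ x then just b else nextIn f (b ∷ r) x

  cycleImg : List ℕ → ℕ → Maybe ℕ
  cycleImg [] x = nothing
  cycleImg (a ∷ r) x = nextIn a (a ∷ r) x

applyCycles : List (List ℕ) → ℕ → ℕ
applyCycles [] x = x
applyCycles (c ∷ cs) x with cycleImg c x
... | just y  = y
... | nothing = applyCycles cs x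

toPoint : ℕ → Point
toPoint n with n <? 33
... | yes h = fromℕ< h
... | no _  = Fin.zero
  where import Data.Fin as Fin

-- the permutation of Point given by a list of disjoint cycles on 1..33
cycles : List (List ℕ) → Perm
cycles cs p = toPoint (pred (applyCycles cs (suc (toℕ p))))

-- For permutations of a finite set the submonoid generated equals the
-- subgroup generated (inverses are positive powers), so we take the
-- closure of the identity under left composition with generators.

data InGroup (gs : List Perm) : Perm → Set where
  gen-id   : InGroup gs (λ p → p)
  gen-step : ∀ {g π} → g ∈ gs → InGroup gs π → InGroup gs (λ p → g (π p))

γ₁ γ₂ γ₄ γ₅ γ₆ γ₁₀ γ₁₁ γ₁₄ γ₁₆ γ₁₈ γ₂₆ γ₂₉ γ₄₃ γ₄₄ : Perm
γ₁ = cycles ((1 ∷ 2 ∷ []) ∷ (3 ∷ 4 ∷ []) ∷ (5 ∷ 6 ∷ []) ∷ (12 ∷ 13 ∷ []) ∷ (14 ∷ 15 ∷ []) ∷ (16 ∷ 17 ∷ []) ∷ (23 ∷ 24 ∷ []) ∷ (25 ∷ 26 ∷ []) ∷ (27 ∷ 28 ∷ []) ∷ [])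
γ₂ = cycles ((12 ∷ 23 ∷ []) ∷ (13 ∷ 24 ∷ []) ∷ (14 ∷ 25 ∷ []) ∷ (15 ∷ 26 ∷ []) ∷ (16 ∷ 27 ∷ []) ∷ (17 ∷ 28 ∷ []) ∷ (18 ∷ 31 ∷ []) ∷ (19 ∷ 29 ∷ []) ∷ (20 ∷ 30 ∷ []) ∷ (21 ∷ 32 ∷ []) ∷ (22 ∷ 33 ∷ []) ∷ [])
γ₄ = cycles ((1 ∷ 2 ∷ []) ∷ (8 ∷ 10 ∷ []) ∷ (9 ∷ 11 ∷ []) ∷ (16 ∷ 17 ∷ []) ∷ (19 ∷ 22 ∷ []) ∷ (20 ∷ 21 ∷ []) ∷ (27 ∷ 28 ∷ []) ∷ (29 ∷ 33 ∷ []) ∷ (30 ∷ 32 ∷ []) ∷ [])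
γ₅ = cycles ((1 ∷ 2 ∷ []) ∷ (8 ∷ 10 ∷ []) ∷ (9 ∷ 11 ∷ []) ∷ (12 ∷ 14 ∷ []) ∷ (13 ∷ 15 ∷ []) ∷ (19 ∷ 22 ∷ []) ∷ (23 ∷ 25 ∷ []) ∷ (24 ∷ 26 ∷ []) ∷ (29 ∷ 33 ∷ []) ∷ [])
γ₆ = cycles ((1 ∷ 2 ∷ []) ∷ (12 ∷ 23 ∷ []) ∷ (13 ∷ 24 ∷ []) ∷ (14 ∷ 25 ∷ []) ∷ (15 ∷ 26 ∷ []) ∷ (16 ∷ 27 ∷ []) ∷ (17 ∷ 28 ∷ []) ∷ (18 ∷ 31 ∷ []) ∷ (19 ∷ 29 ∷ []) ∷ (20 ∷ 30 ∷ []) ∷ (21 ∷ 32 ∷ []) ∷ (22 ∷ 33 ∷ []) ∷ [])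
γ₁₀ = cycles ((1 ∷ 2 ∷ []) ∷ (3 ∷ 5 ∷ []) ∷ (4 ∷ 6 ∷ []) ∷ (8 ∷ 10 ∷ []) ∷ (9 ∷ 11 ∷ []) ∷ (12 ∷ 23 ∷ []) ∷ (13 ∷ 24 ∷ []) ∷ (14 ∷ 25 ∷ []) ∷ (15 ∷ 26 ∷ []) ∷ (16 ∷ 27 ∷ []) ∷ (17 ∷ 28 ∷ []) ∷ (18 ∷ 31 ∷ []) ∷ (19 ∷ 29 ∷ []) ∷ (20 ∷ 30 ∷ []) ∷ (21 ∷ 32 ∷ []) ∷ (22 ∷ 33 ∷ []) ∷ [])
γ₁₁ = cycles ((1 ∷ 2 ∷ []) ∷ (8 ∷ 10 ∷ []) ∷ (9 ∷ 11 ∷ []) ∷ (16 ∷ 17 ∷ []) ∷ (19 ∷ 22 ∷ []) ∷ (20 ∷ 21 ∷ []) ∷ (23 ∷ 25 ∷ []) ∷ (24 ∷ 26 ∷ []) ∷ (29 ∷ 33 ∷ []) ∷ [])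
γ₁₄ = cycles ((3 ∷ 5 ∷ []) ∷ (4 ∷ 6 ∷ []) ∷ (9 ∷ 11 ∷ []) ∷ (12 ∷ 14 ∷ []) ∷ (13 ∷ 15 ∷ []) ∷ (19 ∷ 22 ∷ []) ∷ (23 ∷ 25 ∷ []) ∷ (24 ∷ 26 ∷ []) ∷ (29 ∷ 33 ∷ []) ∷ [])
γ₁₆ = cycles ((1 ∷ 2 ∷ []) ∷ (3 ∷ 4 ∷ []) ∷ (5 ∷ 6 ∷ []) ∷ (7 ∷ 8 ∷ []) ∷ (12 ∷ 13 ∷ []) ∷ (14 ∷ 15 ∷ []) ∷ (16 ∷ 17 ∷ []) ∷ (18 ∷ 19 ∷ []) ∷ (23 ∷ 24 ∷ []) ∷ (25 ∷ 26 ∷ []) ∷ (27 ∷ 28 ∷ []) ∷ (29 ∷ 30 ∷ []) ∷ [])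
γ₁₈ = cycles ((1 ∷ 3 ∷ []) ∷ (2 ∷ 4 ∷ []) ∷ (5 ∷ 7 ∷ []) ∷ (6 ∷ 8 ∷ []) ∷ (12 ∷ 15 ∷ []) ∷ (13 ∷ 14 ∷ []) ∷ (16 ∷ 17 ∷ []) ∷ (21 ∷ 22 ∷ []) ∷ (23 ∷ 26 ∷ []) ∷ (24 ∷ 25 ∷ []) ∷ (27 ∷ 28 ∷ []) ∷ (32 ∷ 33 ∷ []) ∷ [])
γ₂₆ = cycles ((1 ∷ 3 ∷ []) ∷ (2 ∷ 4 ∷ []) ∷ (5 ∷ 7 ∷ []) ∷ (6 ∷ 8 ∷ []) ∷ (10 ∷ 11 ∷ []) ∷ (12 ∷ 23 ∷ []) ∷ (13 ∷ 24 ∷ []) ∷ (14 ∷ 25 ∷ []) ∷ (15 ∷ 26 ∷ []) ∷ (16 ∷ 27 ∷ []) ∷ (17 ∷ 28 ∷ []) ∷ (18 ∷ 29 ∷ []) ∷ (19 ∷ 30 ∷ []) ∷ (20 ∷ 31 ∷ []) ∷ (21 ∷ 33 ∷ []) ∷ (22 ∷ 32 ∷ []) ∷ [])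
γ₂₉ = cycles ((1 ∷ 3 ∷ []) ∷ (2 ∷ 4 ∷ []) ∷ (7 ∷ 8 ∷ []) ∷ (10 ∷ 11 ∷ []) ∷ (12 ∷ 14 ∷ []) ∷ (13 ∷ 15 ∷ []) ∷ (16 ∷ 18 ∷ []) ∷ (17 ∷ 19 ∷ []) ∷ (23 ∷ 26 ∷ []) ∷ (24 ∷ 25 ∷ []) ∷ (27 ∷ 30 ∷ []) ∷ (28 ∷ 29 ∷ []) ∷ [])
γ₄₃ = cycles ((1 ∷ 2 ∷ 3 ∷ 4 ∷ []) ∷ (5 ∷ 6 ∷ 7 ∷ 8 ∷ []) ∷ (12 ∷ 13 ∷ 14 ∷ 15 ∷ []) ∷ (16 ∷ 17 ∷ 18 ∷ 19 ∷ []) ∷ (20 ∷ 21 ∷ []) ∷ (23 ∷ 24 ∷ 25 ∷ 26 ∷ []) ∷ (27 ∷ 28 ∷ 29 ∷ 30 ∷ []) ∷ (31 ∷ 32 ∷ []) ∷ [])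
γ₄₄ = cycles ((1 ∷ 2 ∷ 3 ∷ 4 ∷ []) ∷ (5 ∷ 6 ∷ 7 ∷ 8 ∷ []) ∷ (12 ∷ 13 ∷ 14 ∷ 15 ∷ []) ∷ (16 ∷ 17 ∷ 18 ∷ 19 ∷ []) ∷ (23 ∷ 24 ∷ 25 ∷ 26 ∷ []) ∷ (27 ∷ 28 ∷ 29 ∷ 30 ∷ []) ∷ (31 ∷ 32 ∷ []) ∷ [])

twelveGroups : List (List Perm)
twelveGroups =
  (γ₁ ∷ γ₂ ∷ []) ∷ (γ₁ ∷ γ₄ ∷ []) ∷ (γ₁ ∷ γ₅ ∷ []) ∷ (γ₁ ∷ γ₆ ∷ []) ∷
  (γ₁ ∷ γ₁₀ ∷ []) ∷ (γ₁ ∷ γ₁₁ ∷ []) ∷ (γ₁ ∷ γ₁₄ ∷ []) ∷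
  (γ₁₆ ∷ γ₁₈ ∷ []) ∷ (γ₁₆ ∷ γ₂₆ ∷ []) ∷ (γ₁₆ ∷ γ₂₉ ∷ []) ∷
  (γ₄₃ ∷ []) ∷ (γ₄₄ ∷ []) ∷ []

module Submission where

-- A Latin square L on R, C, S is read as a set E of cells (r, c, s) of
-- indices in Fin 11 such that any two coordinates of an entry determine
-- it and every pair of values in two coordinates is taken
-- (LatinSquare).  A permutation fixing L and preserving the classes acts
-- on E as an autotopism (r,c,s) ↦ (α r, β c, γ s); one fixing R and
-- exchanging C with S acts as a conjugation (r,c,s) ↦ (ρ r, κ s, σ c).
--
-- Two entries never agree in exactly two coordinates, so a cell whose
-- image under such a symmetry agrees with it in exactly two coordinates
-- is not an entry ("excluded").  For nine of the groups this suffices: a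
-- row or column has no admissible cell for some symbol, a symbol is
-- forced into one cell together with another symbol, or three cells of a
-- row are confined to two symbols.  These exclusions are decidable and
-- are checked by evaluation.
--
-- For ⟨γ₁,γ₂⟩, ⟨γ₁,γ₆⟩ and ⟨γ₁,γ₁₀⟩ we use that in a row r fixed by a
-- conjugation the map ψ c = κ (symbol at (r,c)) is an involution of the
-- columns whose fixed points are the "diagonal" cells (r, c, σ c).
-- Counting arguments for involutions of Fin (6 + 5) then produce either
-- too many diagonal cells, or one entry at one of six fixed positions in
-- each of eight γ₁-orbits of rows, which is impossible since a position
-- determines its row.
--
-- Indices are 0-based within each class: index i of class k (R, C, S =
-- 0, 1, 2) is the paper's point 11k + i + 1.

open import Defs
open import Data.Nat using (ℕ; _<_; _≤_; _+_; s≤s; z≤n) renaming (_≟_ to _≟ℕ_)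
open import Data.Nat.Properties using (1+n≰n; +-cancelˡ-≤)
open import Data.Fin using (Fin; zero; suc; toℕ; #_; _↑ˡ_; _↑ʳ_; combine; remQuot; quotient; remainder; splitAt; join)
open import Data.Fin.Properties
  using (_≟_; all?; any?; toℕ-injective; injective⇒≤; <⇒notInjective; remQuot-combine; combine-remQuot;
         ↑ˡ-injective; ↑ʳ-injective; join-splitAt; splitAt-↑ˡ; splitAt-↑ʳ)
open import Data.List using (List; []; _∷_; length; lookup)
open import Data.List.Relation.Unary.All using (All; []; _∷_)
import Data.List.Relation.Unary.All as All
open import Data.List.Relation.Unary.Any using (Any; here; there)
import Data.List.Relation.Unary.Any as Any
open import Data.List.Relation.Unary.Any.Properties using (lookup-index)
open import Data.List.Membership.Propositional using (_∈_)
open import Data.List.Membership.Propositional.Properties using (∈-lookup)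
open import Data.List.Membership.DecPropositional (_≟_ {11}) using (_∈?_)
open import Data.Product using (∃; _×_; _,_; proj₁; proj₂)
open import Data.Product.Properties using (,-injective; ≡-dec)
open import Data.Sum using (_⊎_; inj₁; inj₂; [_,_]′)
open import Data.Empty using (⊥; ⊥-elim)
open import Function using (_∘_; id)
open import Function.Definitions using (Injective)
open import Relation.Nullary using (¬_; Dec; yes; no)
open import Relation.Nullary.Decidable using (True; toWitness; _×-dec_; _⊎-dec_; _→-dec_; ¬?)
open import Relation.Binary.PropositionalEquality

Ix : Set
Ix = Fin 11

pattern ROW = zero
pattern COL = suc zero
pattern SYM = suc (suc zero)

point : Fin 3 → Ix → Point
point = combine

classOf : Point → Fin 3
classOf = quotient 11

index : Point → Ix
index = remainder {3} 11

point-injective : ∀ {k l i j} → point k i ≡ point l j → k ≡ l × i ≡ j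
point-injective {k} {l} {i} {j} eq =
  ,-injective (trans (sym (remQuot-combine k i)) (trans (cong (remQuot 11) eq) (remQuot-combine l j)))

point-index : ∀ p → point (classOf p) (index p) ≡ p
point-index = combine-remQuot {3} 11

cls-point : ∀ k i → cls (point k i) ≡ toℕ k
cls-point = toWitness {a? = all? λ k → all? λ i → cls (point k i) ≟ℕ toℕ k} _

class-from-cls : ∀ {p k} → cls p ≡ toℕ k → classOf p ≡ k
class-from-cls {p} {k} h =
  toℕ-injective (trans (sym (cls-point (classOf p) (index p))) (trans (cong cls (point-index p)) h))

Cell : Set
Cell = Ix × Ix × Ix

coordinate : Fin 3 → Cell → Ix
coordinate ROW (r , _ , _) = r
coordinate COL (_ , c , _) = c
coordinate SYM (_ , _ , s) = s

tripleOf : Cell → Triple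
tripleOf (r , c , s) = point ROW r , point COL c , point SYM s

Entries : TripleSet → Cell → Set
Entries L e = L (tripleOf e)

member-coordinate : ∀ k {i} e → point k i ∈ₜ tripleOf e → coordinate k e ≡ i
member-coordinate k {i} (r , c , s) (inj₁ eq)
  with refl , refl ← point-injective {k} {ROW} {i} {r} eq = refl
member-coordinate k {i} (r , c , s) (inj₂ (inj₁ eq))
  with refl , refl ← point-injective {k} {COL} {i} {c} eq = refl
member-coordinate k {i} (r , c , s) (inj₂ (inj₂ eq))
  with refl , refl ← point-injective {k} {SYM} {i} {s} eq = refl

triple-cell : ∀ {L} → IsLatinSquare L → ∀ {t} → L t → ∃ λ e → t ≡ tripleOf e
triple-cell (typed , _) {a , b , d} Lt with typed a b d Lt
... | in-R , in-C , in-S =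
  (index a , index b , index d) ,
  cong₂ _,_ (at in-R) (cong₂ _,_ (at in-C) (at in-S))
  where
    at : ∀ {p} {k : Fin 3} → cls p ≡ toℕ k → p ≡ point k (index p)
    at {p} {k} h = trans (sym (point-index p)) (cong (λ k → point k (index p)) (class-from-cls {p} {k} h))

record LatinSquare (E : Cell → Set) : Set where
  field
    symbolAt : ∀ r c → ∃ λ s → E (r , c , s)
    columnOf : ∀ r s → ∃ λ c → E (r , c , s)
    rowOf    : ∀ c s → ∃ λ r → E (r , c , s)
    same-symbol : ∀ {r c s s′} → E (r , c , s) → E (r , c , s′) → s ≡ s′
    same-column : ∀ {r c c′ s} → E (r , c , s) → E (r , c′ , s) → c ≡ c′
    same-row    : ∀ {r r′ c s} → E (r , c , s) → E (r′ , c , s) → r ≡ r′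

coordinate-member : ∀ k e → point k (coordinate k e) ∈ₜ tripleOf e
coordinate-member ROW e = inj₁ refl
coordinate-member COL e = inj₂ (inj₁ refl)
coordinate-member SYM e = inj₂ (inj₂ refl)

cell-ext : ∀ {e e′} → (∀ k → coordinate k e ≡ coordinate k e′) → e ≡ e′
cell-ext eq = cong₂ _,_ (eq ROW) (cong₂ _,_ (eq COL) (eq SYM))

tripleOf-injective : ∀ {e e′} → tripleOf e ≡ tripleOf e′ → e ≡ e′
tripleOf-injective {e} {e′} eq = cell-ext λ k →
  sym (member-coordinate k e′ (subst (point k (coordinate k e) ∈ₜ_) eq (coordinate-member k e)))

module _ {L : TripleSet} (sq : IsLatinSquare L) where

  private
    different-classes : ∀ {k l : Fin 3} {i j} → toℕ k ≢ toℕ l → cls (point k i) ≡ cls (point l j) → ⊥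
    different-classes {k} {l} {i} {j} k≢l eq = k≢l (trans (sym (cls-point k i)) (trans eq (cls-point l j)))

  through : ∀ {k l : Fin 3} → toℕ k ≢ toℕ l → ∀ i j →
            ∃ λ e → Entries L e × coordinate k e ≡ i × coordinate l e ≡ j
  through {k} {l} k≢l i j
    with t , Lt , kt , lt , _ ← proj₂ sq (point k i) (point l j) (different-classes k≢l)
    with e , refl ← triple-cell sq Lt
    = e , Lt , member-coordinate k e kt , member-coordinate l e lt

  same-triple : ∀ {k l : Fin 3} {i j} → toℕ k ≢ toℕ l → ∀ {u u′} → L u → L u′ →
                point k i ∈ₜ u → point l j ∈ₜ u → point k i ∈ₜ u′ → point l j ∈ₜ u′ → u ≡ u′
  same-triple {k} {l} {i} {j} k≢l Lu Lu′ ku lu ku′ lu′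
    with _ , _ , _ , _ , only-one ← proj₂ sq (point k i) (point l j) (different-classes k≢l)
    = trans (only-one _ Lu ku lu) (sym (only-one _ Lu′ ku′ lu′))

  unique-through : ∀ {k l : Fin 3} → toℕ k ≢ toℕ l → ∀ {e e′} → Entries L e → Entries L e′ →
                   coordinate k e ≡ coordinate k e′ → coordinate l e ≡ coordinate l e′ → e ≡ e′
  unique-through {k} {l} k≢l {e} {e′} Le Le′ ek el =
    tripleOf-injective (same-triple k≢l Le Le′ (coordinate-member k e) (coordinate-member l e)
                                   (subst (λ i → point k i ∈ₜ _) (sym ek) (coordinate-member k e′))
                                   (subst (λ j → point l j ∈ₜ _) (sym el) (coordinate-member l e′)))

  latinSquare : LatinSquare (Entries L)
  latinSquare = record
    { symbolAt = symbolAt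
    ; columnOf = columnOf
    ; rowOf    = rowOf
    ; same-symbol = λ Le Le′ → cong (coordinate SYM) (unique-through {ROW} {COL} (λ ()) Le Le′ refl refl)
    ; same-column = λ Le Le′ → cong (coordinate COL) (unique-through {ROW} {SYM} (λ ()) Le Le′ refl refl)
    ; same-row    = λ Le Le′ → cong (coordinate ROW) (unique-through {COL} {SYM} (λ ()) Le Le′ refl refl)
    }
    where
      symbolAt : ∀ r c → ∃ λ s → Entries L (r , c , s)
      symbolAt r c = symbol-of (through {ROW} {COL} (λ ()) r c)
        where
          symbol-of : (∃ λ e → Entries L e × coordinate ROW e ≡ r × coordinate COL e ≡ c) → ∃ λ s → Entries L (r , c , s)
          symbol-of ((_ , _ , s) , Le , refl , refl) = s , Le
      columnOf : ∀ r s → ∃ λ c → Entries L (r , c , s)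
      columnOf r s = column-of (through {ROW} {SYM} (λ ()) r s)
        where
          column-of : (∃ λ e → Entries L e × coordinate ROW e ≡ r × coordinate SYM e ≡ s) → ∃ λ c → Entries L (r , c , s)
          column-of ((_ , c , _) , Le , refl , refl) = c , Le
      rowOf : ∀ c s → ∃ λ r → Entries L (r , c , s)
      rowOf c s = row-of (through {COL} {SYM} (λ ()) c s)
        where
          row-of : (∃ λ e → Entries L e × coordinate COL e ≡ c × coordinate SYM e ≡ s) → ∃ λ r → Entries L (r , c , s)
          row-of ((r , _ , _) , Le , refl , refl) = r , Le

Symmetry : (Cell → Set) → (Cell → Cell) → Set
Symmetry E τ = ∀ e → E e → E (τ e)

-- f applied after evaluating its argument constructor by constructor, so
-- that in nested applications (checked by evaluation below) an argument
-- is evaluated once rather than at each of its uses.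
strict : ∀ {n} {A : Set} → (Fin n → A) → Fin n → A
strict f zero    = f zero
strict f (suc i) = strict (λ j → f (suc j)) i

strict-≗ : ∀ {n} {A : Set} (f : Fin n → A) → strict f ≗ f
strict-≗ f zero    = refl
strict-≗ f (suc i) = strict-≗ (λ j → f (suc j)) i

restrict : Perm → Fin 3 → Ix → Ix
restrict π k = strict λ i → index (π (point k i))

MapsClass : Perm → Fin 3 → Fin 3 → Set
MapsClass π k l = ∀ i → classOf (π (point k i)) ≡ l

mapsClass? : ∀ π k l → Dec (MapsClass π k l)
mapsClass? π k l = all? λ i → classOf (π (point k i)) ≟ l

maps-point : ∀ π k l → MapsClass π k l → ∀ i → π (point k i) ≡ point l (restrict π k i)
maps-point π k l h i =
  trans (sym (point-index (π (point k i))))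
        (cong₂ point (h i) (sym (strict-≗ (λ i → index (π (point k i))) i)))

Autotopic : Perm → Set
Autotopic π = MapsClass π ROW ROW × MapsClass π COL COL × MapsClass π SYM SYM

autotopic? : ∀ π → Dec (Autotopic π)
autotopic? π = mapsClass? π ROW ROW ×-dec mapsClass? π COL COL ×-dec mapsClass? π SYM SYM

autotopism : (α β γ : Ix → Ix) → Cell → Cell
autotopism α β γ (r , c , s) = α r , β c , γ s

autotopismOf : Perm → Cell → Cell
autotopismOf π = autotopism (restrict π ROW) (restrict π COL) (restrict π SYM)

ExchangesCS : Perm → Set
ExchangesCS π = MapsClass π ROW ROW × MapsClass π COL SYM × MapsClass π SYM COL

exchangesCS? : ∀ π → Dec (ExchangesCS π)
exchangesCS? π = mapsClass? π ROW ROW ×-dec mapsClass? π COL SYM ×-dec mapsClass? π SYM COL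

conjugation : (ρ κ σ : Ix → Ix) → Cell → Cell
conjugation ρ κ σ (r , c , s) = ρ r , κ s , σ c

conjugationOf : Perm → Cell → Cell
conjugationOf π = conjugation (restrict π ROW) (restrict π SYM) (restrict π COL)

module _ {L : TripleSet} (sq : IsLatinSquare L) {π : Perm} (fixes : Fixes π L) where

  image-entry : ∀ {e} → Entries L e → ∀ e′ → (∀ k → point k (coordinate k e′) ∈ₜ imageTriple π (tripleOf e)) → Entries L e′
  image-entry {e} Le e′ on-image
    with u , Lu , same ← proj₁ fixes (tripleOf e) Le
    with e′′ , refl ← triple-cell sq Lu
    = subst (Entries L) (cell-ext λ k → member-coordinate k e′′ (proj₁ (same _) (on-image k))) Lu

  autotopy : True (autotopic? π) → Symmetry (Entries L) (autotopismOf π)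
  autotopy t (r , c , s) Le = image-entry Le _ (on-image (toWitness {a? = autotopic? π} t))
    where
      on-image : Autotopic π → ∀ k →
                 point k (coordinate k (autotopismOf π (r , c , s))) ∈ₜ imageTriple π (tripleOf (r , c , s))
      on-image (R→R , _ , _) ROW = inj₁ (sym (maps-point π ROW ROW R→R r))
      on-image (_ , C→C , _) COL = inj₂ (inj₁ (sym (maps-point π COL COL C→C c)))
      on-image (_ , _ , S→S) SYM = inj₂ (inj₂ (sym (maps-point π SYM SYM S→S s)))

  conjugacy : True (exchangesCS? π) → Symmetry (Entries L) (conjugationOf π)
  conjugacy t (r , c , s) Le = image-entry Le _ (on-image (toWitness {a? = exchangesCS? π} t))
    where
      on-image : ExchangesCS π → ∀ k →
                 point k (coordinate k (conjugationOf π (r , c , s))) ∈ₜ imageTriple π (tripleOf (r , c , s))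
      on-image (R→R , _ , _) ROW = inj₁ (sym (maps-point π ROW ROW R→R r))
      on-image (_ , _ , S→C) COL = inj₂ (inj₂ (sym (maps-point π SYM COL S→C s)))
      on-image (_ , C→S , _) SYM = inj₂ (inj₁ (sym (maps-point π COL SYM C→S c)))

-- Two entries of a Latin square never agree in exactly
-- two coordinates ("clash"), so a cell clashing with its image under a
-- symmetry is not an entry.

Clash : Cell → Cell → Set
Clash (r , c , s) (r′ , c′ , s′) =
  (r ≡ r′ × c ≡ c′ × s ≢ s′) ⊎ (r ≡ r′ × c ≢ c′ × s ≡ s′) ⊎ (r ≢ r′ × c ≡ c′ × s ≡ s′)

clash? : ∀ e e′ → Dec (Clash e e′)
clash? (r , c , s) (r′ , c′ , s′) =
  (r ≟ r′ ×-dec c ≟ c′ ×-dec ¬? (s ≟ s′)) ⊎-dec (r ≟ r′ ×-dec ¬? (c ≟ c′) ×-dec s ≟ s′) ⊎-dec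
  (¬? (r ≟ r′) ×-dec c ≟ c′ ×-dec s ≟ s′)

Excluded : List (Cell → Cell) → Cell → Set
Excluded τs e = Any (λ τ → Clash e (τ e)) τs

excluded? : ∀ τs e → Dec (Excluded τs e)
excluded? τs e = Any.any? (λ τ → clash? e (τ e)) τs

only : ∀ {A B : Set} → ¬ A → A ⊎ B → B
only ¬a (inj₁ a) = ⊥-elim (¬a a)
only ¬a (inj₂ b) = b

Distinct : List Ix → Set
Distinct cs = ∀ i j → lookup cs i ≡ lookup cs j → i ≡ j

distinct? : ∀ cs → Dec (Distinct cs)
distinct? cs = all? λ i → all? λ j → (lookup cs i ≟ lookup cs j) →-dec (i ≟ j)

Confined : List (Cell → Cell) → Ix → List Ix → List Ix → Set
Confined τs r cs ss = ∀ i v → Excluded τs (r , lookup cs i , v) ⊎ v ∈ ss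

confined? : ∀ τs r cs ss → Dec (Confined τs r cs ss)
confined? τs r cs ss = all? λ i → all? λ v → excluded? τs (r , lookup cs i , v) ⊎-dec (v ∈? ss)

module _ {E : Cell → Set} (sq : LatinSquare E) where
  open LatinSquare sq

  no-clash : ∀ {e e′} → E e → E e′ → ¬ Clash e e′
  no-clash Le Le′ (inj₁ (refl , refl , s≢s′))        = s≢s′ (same-symbol Le Le′)
  no-clash Le Le′ (inj₂ (inj₁ (refl , c≢c′ , refl))) = c≢c′ (same-column Le Le′)
  no-clash Le Le′ (inj₂ (inj₂ (r≢r′ , refl , refl))) = r≢r′ (same-row Le Le′)

  not-excluded : ∀ {τs} → All (Symmetry E) τs → ∀ {e} → E e → ¬ Excluded τs e
  not-excluded (τ-sym ∷ _)    Le (here clash) = no-clash Le (τ-sym _ Le) clash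
  not-excluded (_ ∷ τs-sym) Le (there ex)   = not-excluded τs-sym Le ex

  -- Symbol s occurs in row r, so not all cells of row r are excluded for it.
  row-lacks-symbol : ∀ {τs} → All (Symmetry E) τs → ∀ r s → True (all? λ c → excluded? τs (r , c , s)) → ⊥
  row-lacks-symbol {τs} syms r s excl =
    not-excluded syms (proj₂ (columnOf r s)) (toWitness {a? = all? λ c → excluded? τs (r , c , s)} excl _)

  -- Symbol s occurs in column c, so not all its cells are excluded for it.
  column-lacks-symbol : ∀ {τs} → All (Symmetry E) τs → ∀ c s → True (all? λ r → excluded? τs (r , c , s)) → ⊥
  column-lacks-symbol {τs} syms c s excl =
    not-excluded syms (proj₂ (rowOf c s)) (toWitness {a? = all? λ r → excluded? τs (r , c , s)} excl _)

  column-rows : ∀ {τs} → All (Symmetry E) τs → ∀ c s (rs : List Ix) →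
                True (all? λ r → (r ∈? rs) ⊎-dec excluded? τs (r , c , s)) → ∃ λ r → r ∈ rs × E (r , c , s)
  column-rows {τs} syms c s rs allowed = place (rowOf c s)
    where
      place : (∃ λ r → E (r , c , s)) → ∃ λ r → r ∈ rs × E (r , c , s)
      place (r , Lr) = [ (λ r∈rs → r , r∈rs , Lr) , (λ ex → ⊥-elim (not-excluded syms Lr ex)) ]′
        (toWitness {a? = all? λ r′ → (r′ ∈? rs) ⊎-dec excluded? τs (r′ , c , s)} allowed r)

  row-pigeonhole : ∀ {τs} → All (Symmetry E) τs → ∀ r (cs ss : List Ix) → length ss < length cs →
                   Distinct cs → Confined τs r cs ss → ⊥
  row-pigeonhole syms r cs ss shorter distinct confinement = <⇒notInjective shorter slot-injective
    where
      symbol-in : ∀ i → ∃ λ v → E (r , lookup cs i , v) × v ∈ ss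
      symbol-in i = in-ss (symbolAt r (lookup cs i))
        where
          in-ss : (∃ λ v → E (r , lookup cs i , v)) → ∃ λ v → E (r , lookup cs i , v) × v ∈ ss
          in-ss (v , Lv) = v , Lv , only (not-excluded syms Lv) (confinement i v)
      slot : Fin (length cs) → Fin (length ss)
      slot i = Any.index (proj₂ (proj₂ (symbol-in i)))
      equal-symbols : ∀ {i j} → slot i ≡ slot j → proj₁ (symbol-in i) ≡ proj₁ (symbol-in j)
      equal-symbols {i} {j} same-slot =
        trans (lookup-index (proj₂ (proj₂ (symbol-in i))))
              (trans (cong (lookup ss) same-slot) (sym (lookup-index (proj₂ (proj₂ (symbol-in j))))))
      slot-injective : Injective _≡_ _≡_ slot
      slot-injective {i} {j} same-slot =
        distinct i j (same-column (proj₁ (proj₂ (symbol-in i)))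
                                  (subst (λ v → E (r , lookup cs j , v)) (sym (equal-symbols same-slot)) (proj₁ (proj₂ (symbol-in j)))))

  row-confined : ∀ {τs} → All (Symmetry E) τs → ∀ r (cs ss : List Ix) → length ss < length cs →
                 True (distinct? cs) → True (confined? τs r cs ss) → ⊥
  row-confined {τs} syms r cs ss shorter distinct confined =
    row-pigeonhole syms r cs ss shorter (toWitness {a? = distinct? cs} distinct) (toWitness {a? = confined? τs r cs ss} confined)

data Side (m n : ℕ) : Fin (m + n) → Set where
  left  : ∀ i → Side m n (i ↑ˡ n)
  right : ∀ j → Side m n (m ↑ʳ j)

side : ∀ m {n} (x : Fin (m + n)) → Side m n x
side m {n} x = subst (Side m n) (join-splitAt m n x) (side-of (splitAt m x))
  where
    side-of : (y : Fin m ⊎ Fin n) → Side m n (join m n y)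
    side-of (inj₁ i) = left i
    side-of (inj₂ j) = right j

left≢right : ∀ {m n} (i : Fin m) (j : Fin n) → i ↑ˡ n ≢ m ↑ʳ j
left≢right {m} {n} i j eq with trans (sym (splitAt-↑ˡ m i n)) (trans (cong (splitAt m) eq) (splitAt-↑ʳ m n j))
... | ()

disjoint-injections : ∀ {a b c} (f : Fin a → Fin b) (g : Fin c → Fin b) →
                      Injective _≡_ _≡_ f → Injective _≡_ _≡_ g → (∀ i j → f i ≢ g j) → a + c ≤ b
disjoint-injections {a} {b} {c} f g f-injective g-injective disjoint = injective⇒≤ both-injective
  where
    both : Fin (a + c) → Fin b
    both x = [ f , g ]′ (splitAt a x)
    cases-injective : ∀ u v → [ f , g ]′ u ≡ [ f , g ]′ v → u ≡ v
    cases-injective (inj₁ i) (inj₁ i′) eq = cong inj₁ (f-injective eq)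
    cases-injective (inj₁ i) (inj₂ j)  eq = ⊥-elim (disjoint i j eq)
    cases-injective (inj₂ j) (inj₁ i)  eq = ⊥-elim (disjoint i j (sym eq))
    cases-injective (inj₂ j) (inj₂ j′) eq = cong inj₂ (g-injective eq)
    both-injective : Injective _≡_ _≡_ both
    both-injective {x} {y} eq =
      trans (sym (join-splitAt a c x)) (trans (cong (join a c) (cases-injective (splitAt a x) (splitAt a y) eq)) (join-splitAt a c y))

module RightToLeftInvolution {m n} (ψ : Fin (m + n) → Fin (m + n)) (involutive : ∀ x → ψ (ψ x) ≡ x)
                             (right→left : ∀ j → ∃ λ i → ψ (m ↑ʳ j) ≡ i ↑ˡ n) where

  image : Fin n → Fin m
  image j = proj₁ (right→left j)

  ψ-injective : Injective _≡_ _≡_ ψ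
  ψ-injective {x} {y} eq = trans (sym (involutive x)) (trans (cong ψ eq) (involutive y))

  image-injective : Injective _≡_ _≡_ image
  image-injective {j} {j′} eq =
    ↑ʳ-injective m j j′ (ψ-injective (trans (proj₂ (right→left j)) (trans (cong (_↑ˡ n) eq) (sym (proj₂ (right→left j′))))))

  -- The left fixed points of ψ lie outside the image of the right part,
  -- so there are at most m ∸ n of them.
  fixed-points-bound : ∀ {k} (d : Fin k → Fin m) → Injective _≡_ _≡_ d →
                       (∀ t → ψ (d t ↑ˡ n) ≡ d t ↑ˡ n) → n + k ≤ m
  fixed-points-bound d d-injective fixed =
    disjoint-injections image d image-injective d-injective λ j t eq →
      left≢right (d t) j (ψ-injective (trans (fixed t) (trans (cong (_↑ˡ n) (sym eq)) (sym (proj₂ (right→left j))))))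

-- With one more left point than right points, ψ has a left fixed point:
-- the single left point missed by the image of the right part is fixed.
module _ {n} (ψ : Fin (1 + n + n) → Fin (1 + n + n)) (involutive : ∀ x → ψ (ψ x) ≡ x)
         (right→left : ∀ j → ∃ λ i → ψ ((1 + n) ↑ʳ j) ≡ i ↑ˡ n) where
  open RightToLeftInvolution ψ involutive right→left

  private
    -- a missed point t is fixed: otherwise t and ψ t are two missed points
    missed-fixed : ∀ t → (∀ j → image j ≢ t) → ∀ x → ψ (t ↑ˡ n) ≡ x → Side (1 + n) n x → ψ (t ↑ˡ n) ≡ t ↑ˡ n
    missed-fixed t missed _ eq (right j) =
      ⊥-elim (missed j (↑ˡ-injective n _ t (trans (sym (proj₂ (right→left j))) (trans (cong ψ (sym eq)) (involutive _)))))
    missed-fixed t missed _ ψt≡u (left u) with u ≟ t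
    ... | yes refl = ψt≡u
    ... | no u≢t = ⊥-elim (1+n≰n (disjoint-injections pair image pair-injective image-injective pair-disjoint))
      where
        pair : Fin 2 → Fin (1 + n)
        pair zero       = t
        pair (suc zero) = u
        pair-injective : Injective _≡_ _≡_ pair
        pair-injective {zero}     {zero}     _  = refl
        pair-injective {zero}     {suc zero} eq = ⊥-elim (u≢t (sym eq))
        pair-injective {suc zero} {zero}     eq = ⊥-elim (u≢t eq)
        pair-injective {suc zero} {suc zero} _  = refl
        pair-disjoint : ∀ p j → pair p ≢ image j
        pair-disjoint zero       j eq = missed j (sym eq)
        pair-disjoint (suc zero) j u≡image =
          left≢right t j (ψ-injective (trans ψt≡u (trans (cong (_↑ˡ n) u≡image) (sym (proj₂ (right→left j))))))

    -- if no point were missed, preimages would inject Fin (1 + n) into Fin n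
    some-missed : ∃ λ t → ∀ j → image j ≢ t
    some-missed with any? (λ t → all? λ j → ¬? (image j ≟ t))
    ... | yes missed = missed
    ... | no covered = ⊥-elim (1+n≰n (injective⇒≤ preimage-injective))
      where
        preimage : ∀ t → ∃ λ j → image j ≡ t
        preimage t with any? (λ j → image j ≟ t)
        ... | yes found = found
        ... | no none   = ⊥-elim (covered (t , λ j eq → none (j , eq)))
        preimage-injective : Injective _≡_ _≡_ (λ t → proj₁ (preimage t))
        preimage-injective {t} {t′} eq = trans (sym (proj₂ (preimage t))) (trans (cong image eq) (proj₂ (preimage t′)))

  left-fixed-point : ∃ λ i → ψ (i ↑ˡ n) ≡ i ↑ˡ n
  left-fixed-point with t , missed ← some-missed = t , missed-fixed t missed _ refl (side (1 + n) (ψ (t ↑ˡ n)))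

swap-pairs : Fin 6 → Fin 6
swap-pairs zero                                   = suc zero
swap-pairs (suc zero)                             = zero
swap-pairs (suc (suc zero))                       = suc (suc (suc zero))
swap-pairs (suc (suc (suc zero)))                 = suc (suc zero)
swap-pairs (suc (suc (suc (suc zero))))           = suc (suc (suc (suc (suc zero))))
swap-pairs (suc (suc (suc (suc (suc zero)))))     = suc (suc (suc (suc zero)))

pairwise : Fin 6 → Fin 6 → Fin 6 → Fin 6 → Fin 6
pairwise a b c zero                               = a
pairwise a b c (suc zero)                         = swap-pairs a
pairwise a b c (suc (suc zero))                   = b
pairwise a b c (suc (suc (suc zero)))             = swap-pairs b
pairwise a b c (suc (suc (suc (suc zero))))       = c
pairwise a b c (suc (suc (suc (suc (suc zero))))) = swap-pairs c

KeepsAPair : (Fin 6 → Fin 6) → Set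
KeepsAPair σ = ∃ λ x → σ x ≡ x ⊎ σ x ≡ swap-pairs x

-- An involution commuting with swap-pairs permutes the three pairs, so
-- (three being odd) it fixes one of them.  Such a map is pairwise a b c
-- for its values at 0, 2, 4; the 6³ candidates are checked by evaluation.
pairwise-keeps-a-pair : ∀ a b c → (∀ x → pairwise a b c (pairwise a b c x) ≡ x) → KeepsAPair (pairwise a b c)
pairwise-keeps-a-pair = toWitness {a? = all? λ a → all? λ b → all? λ c →
  (all? λ x → pairwise a b c (pairwise a b c x) ≟ x) →-dec
  any? (λ x → (pairwise a b c x ≟ x) ⊎-dec (pairwise a b c x ≟ swap-pairs x))} _

involution-keeps-a-pair : (σ : Fin 6 → Fin 6) → (∀ x → σ (σ x) ≡ x) → (∀ x → σ (swap-pairs x) ≡ swap-pairs (σ x)) →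
                          KeepsAPair σ
involution-keeps-a-pair σ involutive commutes = transfer (pairwise-keeps-a-pair a b c pairwise-involutive)
  where
    a b c : Fin 6
    a = σ zero
    b = σ (suc (suc zero))
    c = σ (suc (suc (suc (suc zero))))
    same : ∀ x → pairwise a b c x ≡ σ x
    same zero                               = refl
    same (suc zero)                         = sym (commutes zero)
    same (suc (suc zero))                   = refl
    same (suc (suc (suc zero)))             = sym (commutes (suc (suc zero)))
    same (suc (suc (suc (suc zero))))       = refl
    same (suc (suc (suc (suc (suc zero))))) = sym (commutes (suc (suc (suc (suc zero)))))
    pairwise-involutive : ∀ x → pairwise a b c (pairwise a b c x) ≡ x
    pairwise-involutive x = trans (same _) (trans (cong σ (same x)) (involutive x))
    transfer : KeepsAPair (pairwise a b c) → KeepsAPair σ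
    transfer (x , inj₁ eq) = x , inj₁ (trans (sym (same x)) eq)
    transfer (x , inj₂ eq) = x , inj₂ (trans (sym (same x)) eq)

-- If (r,c,s) ↦ (ρ r, κ s, σ c) preserves
-- the entries, κ ∘ σ = id and ρ r = r, then ψ c = κ (symbol at (r,c)) is
-- an involution of the columns whose fixed points are the columns c with
-- symbol σ c in row r (the "diagonal" cells of row r).

leftIx : Fin 6 → Ix
leftIx i = i ↑ˡ 5

rightIx : Fin 5 → Ix
rightIx j = 6 ↑ʳ j

Left : Ix → Set
Left x = ∃ λ i → x ≡ leftIx i

left? : ∀ x → Dec (Left x)
left? x = any? λ i → x ≟ leftIx i

SentLeft : List (Cell → Cell) → (Ix → Ix) → Ix → Ix → Set
SentLeft τs κ r c = ∀ v → Excluded τs (r , c , v) ⊎ Left (κ v)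

sentLeft? : ∀ τs κ r c → Dec (SentLeft τs κ r c)
sentLeft? τs κ r c = all? λ v → excluded? τs (r , c , v) ⊎-dec left? (κ v)

module ConjugateRow {E : Cell → Set} (sq : LatinSquare E) {ρ κ σ : Ix → Ix}
                    (conj-sym : Symmetry E (conjugation ρ κ σ)) (κσ : ∀ c → κ (σ c) ≡ c)
                    (r : Ix) (ρr : ρ r ≡ r) where
  open LatinSquare sq

  ψ : Ix → Ix
  ψ c = κ (proj₁ (symbolAt r c))

  ψ-entry : ∀ c → E (r , ψ c , σ c)
  ψ-entry c = subst (λ r′ → E (r′ , ψ c , σ c)) ρr (conj-sym _ (proj₂ (symbolAt r c)))

  ψ-involutive : ∀ c → ψ (ψ c) ≡ c
  ψ-involutive c = trans (cong κ (same-symbol (proj₂ (symbolAt r (ψ c))) (ψ-entry c))) (κσ c)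

  fixed⇒diagonal : ∀ {c} → ψ c ≡ c → E (r , c , σ c)
  fixed⇒diagonal {c} fixed = subst (λ c′ → E (r , c′ , σ c)) fixed (ψ-entry c)

  diagonal⇒fixed : ∀ {c} → E (r , c , σ c) → ψ c ≡ c
  diagonal⇒fixed {c} diagonal = same-column (ψ-entry c) diagonal

  sent-left : ∀ {τs} → All (Symmetry E) τs → ∀ {c} → SentLeft τs κ r c → Left (ψ c)
  sent-left syms {c} sent = only (not-excluded sq syms (proj₂ (symbolAt r c))) (sent _)

  module _ {τs} (syms : All (Symmetry E) τs) (right→left : ∀ j → SentLeft τs κ r (rightIx j)) where
    open RightToLeftInvolution {6} {5} ψ ψ-involutive (λ j → sent-left syms (right→left j))

    -- ψ maps the five right columns into the six left ones, so it has a
    -- left fixed point: row r has a diagonal cell in a left column.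
    left-diagonal : ∃ λ i → E (r , leftIx i , σ (leftIx i))
    left-diagonal = diagonal-from (left-fixed-point {5} ψ ψ-involutive (λ j → sent-left syms (right→left j)))
      where
        diagonal-from : (∃ λ i → ψ (leftIx i) ≡ leftIx i) → ∃ λ i → E (r , leftIx i , σ (leftIx i))
        diagonal-from (i , fixed) = i , fixed⇒diagonal fixed

    -- the left diagonal cells are fixed points of ψ outside the image of
    -- the right columns: there is at most one
    at-most-one-left-diagonal : ∀ {k} (d : Fin k → Fin 6) → Injective _≡_ _≡_ d →
                                (∀ t → E (r , leftIx (d t) , σ (leftIx (d t)))) → k ≤ 1
    at-most-one-left-diagonal {k} d d-injective diagonal =
      +-cancelˡ-≤ 5 k 1 (fixed-points-bound d d-injective λ t → diagonal⇒fixed (diagonal t))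

  -- If an autotopism (α, β, γ) fixes row r, acts on the left columns as
  -- swap-pairs and satisfies κ ∘ γ = β ∘ κ, and ψ keeps the left columns,
  -- then ψ restricted to them commutes with swap-pairs and so keeps a
  -- pair: some left column x has the symbol σ of x or of its partner.
  pair-diagonal : ∀ {τs} → All (Symmetry E) τs → ∀ {α β γ} → Symmetry E (autotopism α β γ) → α r ≡ r →
                  (∀ s → κ (γ s) ≡ β (κ s)) → (∀ x → β (leftIx x) ≡ leftIx (swap-pairs x)) →
                  (∀ x → SentLeft τs κ r (leftIx x)) →
                  ∃ λ x → E (r , leftIx x , σ (leftIx x)) ⊎ E (r , leftIx x , σ (leftIx (swap-pairs x)))
  pair-diagonal syms {α} {β} {γ} α-sym αr κγ β-pairs left→left =
    from-pair (involution-keeps-a-pair σ₆ σ₆-involutive σ₆-commutes)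
    where
      σ₆ : Fin 6 → Fin 6
      σ₆ x = proj₁ (sent-left syms (left→left x))
      σ₆-spec : ∀ x → ψ (leftIx x) ≡ leftIx (σ₆ x)
      σ₆-spec x = proj₂ (sent-left syms (left→left x))
      σ₆-involutive : ∀ x → σ₆ (σ₆ x) ≡ x
      σ₆-involutive x =
        ↑ˡ-injective 5 _ _ (trans (sym (σ₆-spec (σ₆ x))) (trans (cong ψ (sym (σ₆-spec x))) (ψ-involutive _)))
      ψ-commutes : ∀ c → ψ (β c) ≡ β (ψ c)
      ψ-commutes c = trans (cong κ (same-symbol (proj₂ (symbolAt r (β c))) image)) (κγ _)
        where
          image : E (r , β c , γ (proj₁ (symbolAt r c)))
          image = subst (λ r′ → E (r′ , β c , γ (proj₁ (symbolAt r c)))) αr (α-sym _ (proj₂ (symbolAt r c)))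
      σ₆-commutes : ∀ x → σ₆ (swap-pairs x) ≡ swap-pairs (σ₆ x)
      σ₆-commutes x = ↑ˡ-injective 5 _ _ (begin
        leftIx (σ₆ (swap-pairs x))  ≡⟨ sym (σ₆-spec _) ⟩
        ψ (leftIx (swap-pairs x))   ≡⟨ cong ψ (sym (β-pairs x)) ⟩
        ψ (β (leftIx x))            ≡⟨ ψ-commutes _ ⟩
        β (ψ (leftIx x))            ≡⟨ cong β (σ₆-spec x) ⟩
        β (leftIx (σ₆ x))           ≡⟨ β-pairs (σ₆ x) ⟩
        leftIx (swap-pairs (σ₆ x))  ∎)
        where open ≡-Reasoning
      column-entry : ∀ x → E (r , leftIx x , σ (leftIx (σ₆ x)))
      column-entry x = subst₂ (λ c′ s′ → E (r , c′ , σ s′)) (ψ-involutive _) (σ₆-spec x) (ψ-entry (ψ (leftIx x)))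
      from-pair : KeepsAPair σ₆ → ∃ λ x → E (r , leftIx x , σ (leftIx x)) ⊎ E (r , leftIx x , σ (leftIx (swap-pairs x)))
      from-pair (x , inj₁ eq) = x , inj₁ (subst (λ y → E (r , leftIx x , σ (leftIx y))) eq (column-entry x))
      from-pair (x , inj₂ eq) = x , inj₂ (subst (λ y → E (r , leftIx x , σ (leftIx y))) eq (column-entry x))

-- A (column, symbol) position determines the row of
-- its entry.  So if rows in k different orbits of an autotopism's row map
-- α each have, in their orbit, an entry at one of fewer than k listed
-- positions, we have a contradiction.

Position : Set
Position = Ix × Ix

position-of : Cell → Position
position-of (_ , c , s) = c , s

module Positions {E : Cell → Set} (sq : LatinSquare E) {α β γ : Ix → Ix} (α-sym : Symmetry E (autotopism α β γ))
                 (positions : List Position) where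
  open LatinSquare sq

  Claimed : Ix → Set
  Claimed r = ∃ λ e → E e × (coordinate ROW e ≡ r ⊎ coordinate ROW e ≡ α r) × position-of e ∈ positions

  Linked : Ix → Ix → Set
  Linked r r′ = r ≡ r′ ⊎ r ≡ α r′ ⊎ α r ≡ r′ ⊎ α r ≡ α r′

  Apart : List Ix → Set
  Apart rs = ∀ i j → Linked (lookup rs i) (lookup rs j) → i ≡ j

  apart? : ∀ rs → Dec (Apart rs)
  apart? rs = all? λ i → all? λ j → linked? (lookup rs i) (lookup rs j) →-dec (i ≟ j)
    where
      linked? : ∀ r r′ → Dec (Linked r r′)
      linked? r r′ = (r ≟ r′) ⊎-dec (r ≟ α r′) ⊎-dec (α r ≟ r′) ⊎-dec (α r ≟ α r′)

  too-few-positions : ∀ rs → True (apart? rs) → length positions < length rs → All Claimed rs → ⊥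
  too-few-positions rs checked fewer claims = <⇒notInjective fewer slot-injective
    where
      apart : Apart rs
      apart = toWitness {a? = apart? rs} checked
      claimed : ∀ i → Claimed (lookup rs i)
      claimed i = All.lookup claims (∈-lookup i)
      slot : Fin (length rs) → Fin (length positions)
      slot i = Any.index (proj₂ (proj₂ (proj₂ (claimed i))))
      same-position : ∀ {i j} → slot i ≡ slot j → position-of (proj₁ (claimed i)) ≡ position-of (proj₁ (claimed j))
      same-position {i} {j} same-slot =
        trans (lookup-index (proj₂ (proj₂ (proj₂ (claimed i)))))
              (trans (cong (lookup positions) same-slot) (sym (lookup-index (proj₂ (proj₂ (proj₂ (claimed j)))))))
      same-row′ : ∀ {e e′} → E e → E e′ → position-of e ≡ position-of e′ → coordinate ROW e ≡ coordinate ROW e′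
      same-row′ {r , c , s} {r′ , .c , .s} Le Le′ refl = same-row Le Le′
      linked : ∀ {x r r′} → x ≡ r ⊎ x ≡ α r → x ≡ r′ ⊎ x ≡ α r′ → Linked r r′
      linked (inj₁ x≡r)  (inj₁ x≡r′)  = inj₁ (trans (sym x≡r) x≡r′)
      linked (inj₁ x≡r)  (inj₂ x≡αr′) = inj₂ (inj₁ (trans (sym x≡r) x≡αr′))
      linked (inj₂ x≡αr) (inj₁ x≡r′)  = inj₂ (inj₂ (inj₁ (trans (sym x≡αr) x≡r′)))
      linked (inj₂ x≡αr) (inj₂ x≡αr′) = inj₂ (inj₂ (inj₂ (trans (sym x≡αr) x≡αr′)))
      slot-injective : Injective _≡_ _≡_ slot
      slot-injective {i} {j} same-slot with claimed i | claimed j | same-position {i} {j} same-slot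
      ... | e , Le , in-i , _ | e′ , Le′ , in-j , _ | same =
        apart i j (linked in-i (subst (λ x → x ≡ lookup rs j ⊎ x ≡ α (lookup rs j)) (sym (same-row′ Le Le′ same)) in-j))

  Claimable : Cell → Set
  Claimable e = position-of e ∈ positions ⊎ position-of (autotopism α β γ e) ∈ positions

  claimable? : ∀ e → Dec (Claimable e)
  claimable? e = position? e ⊎-dec position? (autotopism α β γ e)
    where
      position? : ∀ e → Dec (position-of e ∈ positions)
      position? e = Any.any? (λ p → ≡-dec _≟_ _≟_ (position-of e) p) positions

  claim : ∀ {r c s} → E (r , c , s) → Claimable (r , c , s) → Claimed r
  claim Le (inj₁ listed) = _ , Le , inj₁ refl , listed
  claim Le (inj₂ listed) = _ , α-sym _ Le , inj₂ refl , listed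

≗? : ∀ {n} (f g : Fin n → Ix) → Dec (f ≗ g)
≗? f g = all? λ x → f x ≟ g x

module DiagonalClaims {E : Cell → Set} (sq : LatinSquare E) {α β γ : Ix → Ix} (α-sym : Symmetry E (autotopism α β γ))
                      (positions : List Position) where
  open Positions sq α-sym positions public

  private
    αs : List (Cell → Cell)
    αs = autotopism α β γ ∷ []

  LeftDiagonalClaim : (ρ κ σ : Ix → Ix) → Ix → Set
  LeftDiagonalClaim ρ κ σ r =
    (κ ∘ σ) ≗ id × ρ r ≡ r × (∀ j → SentLeft αs κ r (rightIx j)) × (∀ i → Claimable (r , leftIx i , σ (leftIx i)))

  leftDiagonalClaim? : ∀ ρ κ σ r → Dec (LeftDiagonalClaim ρ κ σ r)
  leftDiagonalClaim? ρ κ σ r =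
    ≗? (κ ∘ σ) id ×-dec ρ r ≟ r ×-dec all? (λ j → sentLeft? αs κ r (rightIx j)) ×-dec
    all? (λ i → claimable? (r , leftIx i , σ (leftIx i)))

  claim-left-diagonal : ∀ {ρ κ σ} → Symmetry E (conjugation ρ κ σ) → ∀ r → True (leftDiagonalClaim? ρ κ σ r) → Claimed r
  claim-left-diagonal {ρ} {κ} {σ} conj-sym r checked = from-conditions (toWitness {a? = leftDiagonalClaim? ρ κ σ r} checked)
    where
      from-diagonal : (∀ i → Claimable (r , leftIx i , σ (leftIx i))) → (∃ λ i → E (r , leftIx i , σ (leftIx i))) → Claimed r
      from-diagonal claimable (i , diagonal) = claim diagonal (claimable i)
      from-conditions : LeftDiagonalClaim ρ κ σ r → Claimed r
      from-conditions (κσ , ρr , right→left , claimable) =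
        from-diagonal claimable (ConjugateRow.left-diagonal sq conj-sym κσ r ρr (α-sym ∷ []) right→left)

  PairDiagonalClaim : (ρ κ σ : Ix → Ix) → Ix → Set
  PairDiagonalClaim ρ κ σ r =
    (κ ∘ σ) ≗ id × ρ r ≡ r × α r ≡ r × (κ ∘ γ) ≗ (β ∘ κ) × (β ∘ leftIx) ≗ (leftIx ∘ swap-pairs) ×
    (∀ x → SentLeft αs κ r (leftIx x)) ×
    (∀ x → Claimable (r , leftIx x , σ (leftIx x)) × Claimable (r , leftIx x , σ (leftIx (swap-pairs x))))

  pairDiagonalClaim? : ∀ ρ κ σ r → Dec (PairDiagonalClaim ρ κ σ r)
  pairDiagonalClaim? ρ κ σ r =
    ≗? (κ ∘ σ) id ×-dec ρ r ≟ r ×-dec α r ≟ r ×-dec ≗? (κ ∘ γ) (β ∘ κ) ×-dec ≗? (β ∘ leftIx) (leftIx ∘ swap-pairs) ×-dec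
    all? (λ x → sentLeft? αs κ r (leftIx x)) ×-dec
    all? (λ x → claimable? (r , leftIx x , σ (leftIx x)) ×-dec claimable? (r , leftIx x , σ (leftIx (swap-pairs x))))

  claim-pair-diagonal : ∀ {ρ κ σ} → Symmetry E (conjugation ρ κ σ) → ∀ r → True (pairDiagonalClaim? ρ κ σ r) → Claimed r
  claim-pair-diagonal {ρ} {κ} {σ} conj-sym r checked = from-conditions (toWitness {a? = pairDiagonalClaim? ρ κ σ r} checked)
    where
      from-diagonal : (∀ x → Claimable (r , leftIx x , σ (leftIx x)) × Claimable (r , leftIx x , σ (leftIx (swap-pairs x)))) →
                      (∃ λ x → E (r , leftIx x , σ (leftIx x)) ⊎ E (r , leftIx x , σ (leftIx (swap-pairs x)))) → Claimed r
      from-diagonal claimable (x , inj₁ diagonal) = claim diagonal (proj₁ (claimable x))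
      from-diagonal claimable (x , inj₂ diagonal) = claim diagonal (proj₂ (claimable x))
      from-conditions : PairDiagonalClaim ρ κ σ r → Claimed r
      from-conditions (κσ , ρr , αr , κγ , β-pairs , left→left , claimable) =
        from-diagonal claimable (ConjugateRow.pair-diagonal sq conj-sym κσ r ρr (α-sym ∷ []) α-sym αr κγ β-pairs left→left)

gen₁ : ∀ {g gs} → InGroup (g ∷ gs) g
gen₁ = gen-step (here refl) gen-id

gen₂ : ∀ {g h gs} → InGroup (g ∷ h ∷ gs) h
gen₂ = gen-step (there (here refl)) gen-id

gen₁₂ : ∀ {g h gs} → InGroup (g ∷ h ∷ gs) (λ p → g (h p))
gen₁₂ = gen-step (here refl) gen₂

gen₁² : ∀ {g gs} → InGroup (g ∷ gs) (λ p → g (g p))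
gen₁² = gen-step (here refl) gen₁

NoInvariantSquare : List Perm → Set₁
NoInvariantSquare gs = ∀ L → IsLatinSquare L → (∀ π → InGroup gs π → Fixes π L) → ⊥

module Invariant {gs} {L : TripleSet} (sq : IsLatinSquare L) (fixes : ∀ π → InGroup gs π → Fixes π L) where
  square : LatinSquare (Entries L)
  square = latinSquare sq

  auto : ∀ {π} → InGroup gs π → True (autotopic? π) → Symmetry (Entries L) (autotopismOf π)
  auto g = autotopy sq (fixes _ g)

  conj : ∀ {π} → InGroup gs π → True (exchangesCS? π) → Symmetry (Entries L) (conjugationOf π)
  conj g = conjugacy sq (fixes _ g)

group-1-5 : NoInvariantSquare (γ₁ ∷ γ₅ ∷ [])
group-1-5 L sq fixes =
  row-lacks-symbol square (auto gen₁ _ ∷ auto gen₂ _ ∷ auto gen₁₂ _ ∷ []) (# 0) (# 7) _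
  where open Invariant sq fixes

group-1-11 : NoInvariantSquare (γ₁ ∷ γ₁₁ ∷ [])
group-1-11 L sq fixes =
  row-lacks-symbol square (auto gen₁ _ ∷ auto gen₂ _ ∷ auto gen₁₂ _ ∷ []) (# 6) (# 0) _
  where open Invariant sq fixes

group-16-18 : NoInvariantSquare (γ₁₆ ∷ γ₁₈ ∷ [])
group-16-18 L sq fixes =
  column-lacks-symbol square (auto gen₁ _ ∷ auto gen₂ _ ∷ auto gen₁₂ _ ∷ []) (# 4) (# 8) _
  where open Invariant sq fixes

group-16-29 : NoInvariantSquare (γ₁₆ ∷ γ₂₉ ∷ [])
group-16-29 L sq fixes =
  row-lacks-symbol square (auto gen₁ _ ∷ auto gen₂ _ ∷ auto gen₁₂ _ ∷ []) (# 4) (# 8) _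
  where open Invariant sq fixes

group-43 : NoInvariantSquare (γ₄₃ ∷ [])
group-43 L sq fixes =
  column-lacks-symbol square (auto gen₁ _ ∷ auto gen₁² _ ∷ []) (# 8) (# 10) _
  where open Invariant sq fixes

group-44 : NoInvariantSquare (γ₄₄ ∷ [])
group-44 L sq fixes =
  row-lacks-symbol square (auto gen₁ _ ∷ auto gen₁² _ ∷ []) (# 8) (# 8) _
  where open Invariant sq fixes

group-16-26 : NoInvariantSquare (γ₁₆ ∷ γ₂₆ ∷ [])
group-16-26 L sq fixes =
  x≢y (same-symbol (in-row-8 (column-rows square syms (# 0) x (# 8 ∷ []) _))
                   (in-row-8 (column-rows square syms (# 0) y (# 8 ∷ []) _)))
  where
    open Invariant sq fixes
    open LatinSquare square
    syms : All (Symmetry (Entries L)) (conjugationOf γ₂₆ ∷ conjugationOf (λ p → γ₁₆ (γ₂₆ p)) ∷ [])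
    syms = conj gen₂ _ ∷ conj gen₁₂ _ ∷ []
    x y : Ix
    x = restrict γ₂₆ COL (# 0)
    y = restrict γ₁₆ SYM x
    x≢y : x ≢ y
    x≢y ()
    in-row-8 : ∀ {s} → (∃ λ r → r ∈ # 8 ∷ [] × Entries L (r , # 0 , s)) → Entries L (# 8 , # 0 , s)
    in-row-8 (_ , here refl , L8) = L8

group-1-4 : NoInvariantSquare (γ₁ ∷ γ₄ ∷ [])
group-1-4 L sq fixes =
  row-confined square (auto gen₁ _ ∷ auto gen₂ _ ∷ []) (# 2) (# 7 ∷ # 8 ∷ # 9 ∷ []) (# 4 ∷ # 5 ∷ []) (s≤s (s≤s (s≤s z≤n))) _ _
  where open Invariant sq fixes

group-1-14 : NoInvariantSquare (γ₁ ∷ γ₁₄ ∷ [])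
group-1-14 L sq fixes =
  row-confined square (auto gen₁ _ ∷ auto gen₂ _ ∷ []) (# 0) (# 6 ∷ # 8 ∷ # 9 ∷ []) (# 4 ∷ # 5 ∷ []) (s≤s (s≤s (s≤s z≤n))) _ _
  where open Invariant sq fixes

pair-positions : (Ix → Ix) → List Position
pair-positions σ = at (# 0) (# 0) ∷ at (# 0) (# 1) ∷ at (# 2) (# 2) ∷ at (# 2) (# 3) ∷ at (# 4) (# 4) ∷ at (# 4) (# 5) ∷ []
  where
    at : Fin 6 → Fin 6 → Position
    at c x = leftIx c , σ (leftIx x)

-- ⟨γ₁,γ₂⟩: with α the autotopism of γ₁ and p the conjugation of γ₂, the
-- rows 6..10 (fixed by both) and the α-orbits {0,1}, {2,3}, {4,5} each
-- claim one of the six positions of pair-positions σp.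
group-1-2 : NoInvariantSquare (γ₁ ∷ γ₂ ∷ [])
group-1-2 L sq fixes =
  too-few-positions (# 6 ∷ # 7 ∷ # 8 ∷ # 9 ∷ # 10 ∷ # 0 ∷ # 2 ∷ # 4 ∷ []) _ (s≤s (s≤s (s≤s (s≤s (s≤s (s≤s (s≤s z≤n)))))))
    (claim-pair-diagonal p (# 6) _ ∷ claim-pair-diagonal p (# 7) _ ∷ claim-pair-diagonal p (# 8) _ ∷
     claim-pair-diagonal p (# 9) _ ∷ claim-pair-diagonal p (# 10) _ ∷
     claim-left-diagonal p (# 0) _ ∷ claim-left-diagonal p (# 2) _ ∷ claim-left-diagonal p (# 4) _ ∷ [])
  where
    open Invariant sq fixes
    p : Symmetry (Entries L) (conjugationOf γ₂)
    p = conj gen₂ _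
    open DiagonalClaims square (auto gen₁ _) (pair-positions (restrict γ₂ COL))

-- ⟨γ₁,γ₆⟩: as for ⟨γ₁,γ₂⟩, except that row 0 is fixed by the conjugation
-- q of γ₁γ₆ rather than that of γ₆.
group-1-6 : NoInvariantSquare (γ₁ ∷ γ₆ ∷ [])
group-1-6 L sq fixes =
  too-few-positions (# 6 ∷ # 7 ∷ # 8 ∷ # 9 ∷ # 10 ∷ # 0 ∷ # 2 ∷ # 4 ∷ []) _ (s≤s (s≤s (s≤s (s≤s (s≤s (s≤s (s≤s z≤n)))))))
    (claim-pair-diagonal p (# 6) _ ∷ claim-pair-diagonal p (# 7) _ ∷ claim-pair-diagonal p (# 8) _ ∷
     claim-pair-diagonal p (# 9) _ ∷ claim-pair-diagonal p (# 10) _ ∷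
     claim-left-diagonal q (# 0) _ ∷ claim-left-diagonal p (# 2) _ ∷ claim-left-diagonal p (# 4) _ ∷ [])
  where
    open Invariant sq fixes
    p : Symmetry (Entries L) (conjugationOf γ₆)
    p = conj gen₂ _
    q : Symmetry (Entries L) (conjugationOf (λ x → γ₁ (γ₆ x)))
    q = conj gen₁₂ _
    open DiagonalClaims square (auto gen₁ _) (pair-positions (restrict γ₆ COL))

-- Let p, q be the conjugations of γ₁₀ and γ₁γ₁₀, with
-- column-to-symbol maps σp, σq.  Row 0 is fixed by q and has at most one
-- left diagonal cell of q, but it has one in each of the three pairs of
-- left columns.
module Group-1-10 {L : TripleSet} (sq : IsLatinSquare L) (fixes : ∀ π → InGroup (γ₁ ∷ γ₁₀ ∷ []) π → Fixes π L) where
  open Invariant sq fixes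
  open LatinSquare square

  E : Cell → Set
  E = Entries L

  γ₁γ₁₀ : Perm
  γ₁γ₁₀ x = γ₁ (γ₁₀ x)

  σp σq κq : Ix → Ix
  σp = restrict γ₁₀ COL
  σq = restrict γ₁γ₁₀ COL
  κq = restrict γ₁γ₁₀ SYM

  α-sym : Symmetry E (autotopismOf γ₁)
  α-sym = auto gen₁ _

  p-syms : All (Symmetry E) (conjugationOf γ₁₀ ∷ [])
  p-syms = conj gen₂ _ ∷ []

  q-syms : All (Symmetry E) (conjugationOf γ₁γ₁₀ ∷ [])
  q-syms = conj gen₁₂ _ ∷ []

  open ConjugateRow square (conj gen₁₂ _) (toWitness {a? = ≗? (κq ∘ σq) id} _) (# 0) refl public

  right→left : ∀ j → SentLeft (autotopismOf γ₁ ∷ []) κq (# 0) (rightIx j)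
  right→left = toWitness {a? = all? λ j → sentLeft? (autotopismOf γ₁ ∷ []) κq (# 0) (rightIx j)} _

  -- Only row 6 can hold σp c in column c and only rows 0, 1, 6 can hold
  -- σq c; as σp c ≢ σq c, σq c lies in row 0 or 1.
  row-0-or-1 : ∀ i → σp (leftIx i) ≢ σq (leftIx i) →
               (∃ λ r → r ∈ # 6 ∷ [] × E (r , leftIx i , σp (leftIx i))) →
               (∃ λ r → r ∈ # 0 ∷ # 1 ∷ # 6 ∷ [] × E (r , leftIx i , σq (leftIx i))) →
               E (# 0 , leftIx i , σq (leftIx i)) ⊎ E (# 1 , leftIx i , σq (leftIx i))
  row-0-or-1 i differ _ (_ , here refl , L0) = inj₁ L0
  row-0-or-1 i differ _ (_ , there (here refl) , L1) = inj₂ L1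
  row-0-or-1 i differ (_ , here refl , L6) (_ , there (there (here refl)) , L6′) = ⊥-elim (differ (same-symbol L6 L6′))

  pair : Fin 6 → Fin 3
  pair = quotient 2

  -- Row 0 has a diagonal cell of q in the pair of i: the cell (r, i, σq i)
  -- with r = 0, or the image under α of the one with r = 1.
  diagonal-at : ∀ i → σp (leftIx i) ≢ σq (leftIx i) → pair (swap-pairs i) ≡ pair i →
                autotopismOf γ₁ (# 1 , leftIx i , σq (leftIx i)) ≡ (# 0 , leftIx (swap-pairs i) , σq (leftIx (swap-pairs i))) →
                (∃ λ r → r ∈ # 6 ∷ [] × E (r , leftIx i , σp (leftIx i))) →
                (∃ λ r → r ∈ # 0 ∷ # 1 ∷ # 6 ∷ [] × E (r , leftIx i , σq (leftIx i))) →
                ∃ λ x → pair x ≡ pair i × E (# 0 , leftIx x , σq (leftIx x))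
  diagonal-at i differ same-pair α-image in-6 in-0-1-6 = from-row (row-0-or-1 i differ in-6 in-0-1-6)
    where
      from-row : E (# 0 , leftIx i , σq (leftIx i)) ⊎ E (# 1 , leftIx i , σq (leftIx i)) →
                 ∃ λ x → pair x ≡ pair i × E (# 0 , leftIx x , σq (leftIx x))
      from-row (inj₁ L0) = i , refl , L0
      from-row (inj₂ L1) = swap-pairs i , same-pair , subst E α-image (α-sym _ L1)

  diagonal-in-pair : ∀ m → ∃ λ x → pair x ≡ m × E (# 0 , leftIx x , σq (leftIx x))
  diagonal-in-pair zero =
    diagonal-at (# 0) (λ ()) refl refl (column-rows square p-syms _ _ (# 6 ∷ []) _) (column-rows square q-syms _ _ (# 0 ∷ # 1 ∷ # 6 ∷ []) _)
  diagonal-in-pair (suc zero) =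
    diagonal-at (# 2) (λ ()) refl refl (column-rows square p-syms _ _ (# 6 ∷ []) _) (column-rows square q-syms _ _ (# 0 ∷ # 1 ∷ # 6 ∷ []) _)
  diagonal-in-pair (suc (suc zero)) =
    diagonal-at (# 4) (λ ()) refl refl (column-rows square p-syms _ _ (# 6 ∷ []) _) (column-rows square q-syms _ _ (# 0 ∷ # 1 ∷ # 6 ∷ []) _)

  pair-diagonal-column : Fin 3 → Fin 6
  pair-diagonal-column m = proj₁ (diagonal-in-pair m)

  pair-diagonal-column-injective : Injective _≡_ _≡_ pair-diagonal-column
  pair-diagonal-column-injective {m} {m′} eq =
    trans (sym (proj₁ (proj₂ (diagonal-in-pair m)))) (trans (cong pair eq) (proj₁ (proj₂ (diagonal-in-pair m′))))

group-1-10 : NoInvariantSquare (γ₁ ∷ γ₁₀ ∷ [])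
group-1-10 L sq fixes =
  three≰one (at-most-one-left-diagonal (α-sym ∷ []) right→left pair-diagonal-column pair-diagonal-column-injective
                                       (λ m → proj₂ (proj₂ (diagonal-in-pair m))))
  where
    open Group-1-10 sq fixes
    three≰one : ¬ (3 ≤ 1)
    three≰one (s≤s ())

no-invariant-square : All NoInvariantSquare twelveGroups
no-invariant-square =
  group-1-2 ∷ group-1-4 ∷ group-1-5 ∷ group-1-6 ∷ group-1-10 ∷ group-1-11 ∷ group-1-14 ∷
  group-16-18 ∷ group-16-26 ∷ group-16-29 ∷ group-43 ∷ group-44 ∷ []

lemma2p3 : ∀ (gs : List Perm) → gs ∈ twelveGroups →
    ¬ (∃ λ (L : TripleSet) → IsLatinSquare L × (∀ π → InGroup gs π → Fixes π L))
lemma2p3 gs member (L , sq , fixes) = All.lookup no-invariant-square member L sq fixes
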